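{- If a graph class $\mathscr C$ is simply existentially monadically dependent, then $\mathscr C$ is pattern-free.
   Context: A unary expansion $\widehat{\mathscr C}$ of $\mathscr C$ is a class of structures each obtained from a graph of $\mathscr C$ by adding unary predicates. $\mathscr C$ is simply existentially monadically dependent if for every unary expansion $\widehat{\mathscr C}$ and every existential formula $\varphi(x,y)$ with two single free variables there is $n$ such that no $\widehat G\in\widehat{\mathscr C}$ contains vertices $v_1,\dots,v_n$ and $w_J$ ($J\subseteq\{1,\dots,n\}$) with $\widehat G\models\varphi(v_i,w_J)\iff i\in J$. For a structure $\widehat G$ and formula $\varphi(x,y)$, $\varphi(\widehat G)$ is the graph on $V(\widehat G)$ with edges $uv$, $u\ne v$, such that $\widehat G\models\varphi(u,v)\lor\varphi(v,u)$. The $r$-subdivision of a graph replaces each edge by a path of length $r+1$. $\mathscr C$ is pattern-free if for every $r\ge1$, every unary expansion $\widehat{\mathscr C}$ and every quantifier-free $\varphi(x,y)$ there is $n$ such that for no $\widehat G\in\widehat{\mathscr C}$ does $\varphi(\widehat G)$ contain the $r$-subdivision of $K_n$ as an induced subgraph. -}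

module Defs where

open import Data.Nat using (ℕ; zero; suc; _+_; _≤_)
open import Data.Fin using (Fin; toℕ) renaming (_<_ to _<ᶠ_)
open import Data.Bool using (Bool; true; false)
open import Data.Product using (Σ; Σ-syntax; ∃-syntax; _×_; _,_)
open import Data.Sum using (_⊎_)
open import Data.Unit using (⊤)
open import Data.Empty using (⊥)
open import Relation.Nullary using (¬_)
open import Relation.Binary.PropositionalEquality using (_≡_; _≢_)
open import Function.Bundles using (_⇔_)
open import Function.Definitions using (Injective)
import Data.Vec.Functional as VF

record Graph : Set where
  field
    size  : ℕ
    adj   : Fin size → Fin size → Bool
    sym   : ∀ u v → adj u v ≡ adj v u
    irrefl : ∀ v → adj v v ≡ false
open Graph public

GraphClass : Set₁
GraphClass = Graph → Set

record Str (k : ℕ) : Set where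
  field
    graph : Graph
    pred  : Fin k → Fin (size graph) → Bool
open Str public

V : ∀ {k} → Str k → Set
V S = Fin (size (graph S))

IsUnaryExpansion : ∀ {k} → GraphClass → (Str k → Set) → Set
IsUnaryExpansion C Ĉ = ∀ S → Ĉ S → C (graph S)

data QF (k m : ℕ) : Set where
  tt ff : QF k m
  eq    : Fin m → Fin m → QF k m
  edge  : Fin m → Fin m → QF k m
  pr    : Fin k → Fin m → QF k m
  neg   : QF k m → QF k m
  and   : QF k m → QF k m → QF k m
  or    : QF k m → QF k m → QF k m

⟦_⟧ : ∀ {k m} → QF k m → (S : Str k) → (Fin m → V S) → Set
⟦ tt ⟧ S ρ = ⊤
⟦ ff ⟧ S ρ = ⊥
⟦ eq x y ⟧ S ρ = ρ x ≡ ρ y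
⟦ edge x y ⟧ S ρ = adj (graph S) (ρ x) (ρ y) ≡ true
⟦ pr i x ⟧ S ρ = pred S i (ρ x) ≡ true
⟦ neg φ ⟧ S ρ = ¬ ⟦ φ ⟧ S ρ
⟦ and φ ψ ⟧ S ρ = ⟦ φ ⟧ S ρ × ⟦ ψ ⟧ S ρ
⟦ or φ ψ ⟧ S ρ = ⟦ φ ⟧ S ρ ⊎ ⟦ ψ ⟧ S ρ

-- Existential formula with m free variables:  ∃ z_1 … z_q . ψ(x̄, z̄),
-- ψ quantifier-free (free variables first, then the bound ones).
record Existential (k m : ℕ) : Set where
  constructor ∃∃
  field
    nbound : ℕ
    body   : QF k (m + nbound)
open Existential public

⟦_⟧∃ : ∀ {k m} → Existential k m → (S : Str k) → (Fin m → V S) → Set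
⟦ φ ⟧∃ S ρ = Σ[ σ ∈ (Fin (nbound φ) → V S) ] ⟦ body φ ⟧ S (ρ VF.++ σ)

pair : ∀ {A : Set} → A → A → Fin 2 → A
pair u v Fin.zero = u
pair u v (Fin.suc _) = v

SimplyExistentiallyMonadicallyDependent : GraphClass → Set₁
SimplyExistentiallyMonadicallyDependent C =
  ∀ (k : ℕ) (Ĉ : Str k → Set) → IsUnaryExpansion C Ĉ →
  (φ : Existential k 2) →
  ∃[ n ] ¬ (Σ[ S ∈ Str k ] Ĉ S ×
             Σ[ v ∈ (Fin n → V S) ] Σ[ w ∈ ((Fin n → Bool) → V S) ]
               (∀ (i : Fin n) (J : Fin n → Bool) →
                  ⟦ φ ⟧∃ S (pair (v i) (w J)) ⇔ (J i ≡ true)))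

φEdge : ∀ {k} → QF k 2 → (S : Str k) → V S → V S → Set
φEdge φ S u v = u ≢ v × (⟦ φ ⟧ S (pair u v) ⊎ ⟦ φ ⟧ S (pair v u))

-- The r-subdivision of K_n: principal vertices Fin n; for every edge
-- {i,j} with i < j, internal vertices (i,j,0),…,(i,j,r-1) forming the
-- path  i – (i,j,0) – … – (i,j,r-1) – j  of length r+1.

data SubV (n r : ℕ) : Set where
  prin  : Fin n → SubV n r
  inner : (i j : Fin n) → .(i <ᶠ j) → Fin r → SubV n r

data SubStep {n r : ℕ} : SubV n r → SubV n r → Set where
  start : ∀ i j .(p : i <ᶠ j) (t : Fin r) → toℕ t ≡ 0 →
          SubStep (prin i) (inner i j p t)
  mid   : ∀ i j .(p : i <ᶠ j) (t t' : Fin r) → toℕ t' ≡ suc (toℕ t) →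
          SubStep (inner i j p t) (inner i j p t')
  end   : ∀ i j .(p : i <ᶠ j) (t : Fin r) → suc (toℕ t) ≡ r →
          SubStep (inner i j p t) (prin j)

SubAdj : ∀ {n r} → SubV n r → SubV n r → Set
SubAdj a b = SubStep a b ⊎ SubStep b a

InducedSubgraph : {A B : Set} → (A → A → Set) → (B → B → Set) → Set
InducedSubgraph {A} {B} R E =
  Σ[ f ∈ (A → B) ] Injective _≡_ _≡_ f × (∀ a b → R a b ⇔ E (f a) (f b))

PatternFree : GraphClass → Set₁
PatternFree C =
  ∀ (r : ℕ) → 1 ≤ r →
  ∀ (k : ℕ) (Ĉ : Str k → Set) → IsUnaryExpansion C Ĉ →
  (φ : QF k 2) →
  ∃[ n ] ¬ (Σ[ S ∈ Str k ] Ĉ S ×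
             InducedSubgraph (SubAdj {n} {r}) (φEdge φ S))

{-# OPTIONS --safe #-}
-- Let the r-subdivision of K_N, N = n + 2ⁿ, sit induced in φ(Ĝ), and split its
-- principal vertices into n element vertices aᵢ and 2ⁿ subset vertices b_J.
-- Colour the inner vertices of the subdivided edges aᵢ – b_J with i ∈ J.  The
-- existential formula "x and y are joined by a φ-walk of length r + 1 through
-- coloured vertices" then holds of (aᵢ, b_J) iff i ∈ J: the subdivided edge
-- itself is such a walk, and since the subdivision is induced, a walk of
-- inner vertices cannot leave the subdivided edge it starts on.  So this one
-- formula shatters n points whenever K_{n + 2ⁿ} is a pattern, which simple
-- existential monadic dependence forbids for large n.
module Submission where

open import Defs hiding (sym)
open import Data.Nat using (ℕ; zero; suc; _+_; _^_)
open import Data.Nat.Properties using (m≤m+n; module ≤-Reasoning)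
open import Data.Fin as Fin
  using (Fin; toℕ; _↑ˡ_; _↑ʳ_; inject₁; fromℕ; funToFin; finToFun)
  renaming (_<_ to _<ᶠ_)
open import Data.Fin.Properties
  using (2↔Bool; finToFun-funToFin; toℕ-↑ˡ; toℕ-↑ʳ; toℕ<n; <⇒≢; ↑ˡ-injective; ↑ʳ-injective;
         toℕ-inject₁; toℕ-fromℕ; any?)
  renaming (_≟_ to _≟ᶠ_)
open import Data.Fin.Induction using (<-weakInduction)
open import Data.Bool using (Bool; true)
open import Data.Bool.Properties using (T-≡) renaming (_≟_ to _≟ᵇ_)
open import Data.Product using (_×_; _,_)
open import Data.Sum using (_⊎_; inj₁; inj₂; swap)
open import Data.Unit using (tt)
open import Data.Empty using (⊥-elim)
open import Relation.Nullary using (¬_; Dec)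
open import Relation.Nullary.Decidable using (isYes; toWitness; fromWitness; map′; _×-dec_)
open import Relation.Binary.PropositionalEquality
  using (_≡_; _≢_; refl; sym; trans; cong; cong₂; subst; subst₂; module ≡-Reasoning)
open import Function using (_∘_; id)
open import Function.Bundles using (_⇔_; mk⇔; Equivalence; Inverse)
import Data.Vec.Functional as VF

subsetCode : ∀ {n} → (Fin n → Bool) → Fin (2 ^ n)
subsetCode J = funToFin (Inverse.from 2↔Bool ∘ J)

_∈ᶜ_ : ∀ {n} → Fin n → Fin (2 ^ n) → Bool
i ∈ᶜ c = Inverse.to 2↔Bool (finToFun c i)

∈ᶜ-subsetCode : ∀ {n} (i : Fin n) J → i ∈ᶜ subsetCode J ≡ J i
∈ᶜ-subsetCode i J = begin
  to (finToFun (funToFin (from ∘ J)) i) ≡⟨ cong to (finToFun-funToFin (from ∘ J) i) ⟩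
  to (from (J i))                       ≡⟨ Inverse.strictlyInverseˡ 2↔Bool (J i) ⟩
  J i                                   ∎
  where
  open ≡-Reasoning
  open Inverse 2↔Bool using (to; from)

expand : ∀ {k} (S : Str k) → (V S → Bool) → Str (suc k)
expand {k} S Q = record { graph = graph S ; pred = pred′ }
  where
  pred′ : Fin (suc k) → V S → Bool
  pred′ Fin.zero    = Q
  pred′ (Fin.suc i) = pred S i

reduct : ∀ {k} → Str (suc k) → Str k
reduct S = record { graph = graph S ; pred = pred S ∘ Fin.suc }

liftQF : ∀ {k m m′} → (Fin m′ → Fin m) → QF k m′ → QF (suc k) m
liftQF σ tt         = tt
liftQF σ ff         = ff
liftQF σ (eq x y)   = eq (σ x) (σ y)
liftQF σ (edge x y) = edge (σ x) (σ y)
liftQF σ (pr i x)   = pr (Fin.suc i) (σ x)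
liftQF σ (neg φ)    = neg (liftQF σ φ)
liftQF σ (and φ ψ)  = and (liftQF σ φ) (liftQF σ ψ)
liftQF σ (or φ ψ)   = or (liftQF σ φ) (liftQF σ ψ)

⟦liftQF⟧ : ∀ {k m m′} (σ : Fin m′ → Fin m) (φ : QF k m′) (S : Str (suc k))
           (ρ : Fin m → V S) (ρ′ : Fin m′ → V S) →
           (∀ x → ρ (σ x) ≡ ρ′ x) → ⟦ liftQF σ φ ⟧ S ρ ≡ ⟦ φ ⟧ (reduct S) ρ′
⟦liftQF⟧ σ tt         S ρ ρ′ ρσ≗ρ′ = refl
⟦liftQF⟧ σ ff         S ρ ρ′ ρσ≗ρ′ = refl
⟦liftQF⟧ σ (eq x y)   S ρ ρ′ ρσ≗ρ′ = cong₂ _≡_ (ρσ≗ρ′ x) (ρσ≗ρ′ y)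
⟦liftQF⟧ σ (edge x y) S ρ ρ′ ρσ≗ρ′ =
  cong₂ (λ u v → adj (graph S) u v ≡ true) (ρσ≗ρ′ x) (ρσ≗ρ′ y)
⟦liftQF⟧ σ (pr i x)   S ρ ρ′ ρσ≗ρ′ = cong (λ u → pred S (Fin.suc i) u ≡ true) (ρσ≗ρ′ x)
⟦liftQF⟧ σ (neg φ)    S ρ ρ′ ρσ≗ρ′ = cong ¬_ (⟦liftQF⟧ σ φ S ρ ρ′ ρσ≗ρ′)
⟦liftQF⟧ σ (and φ ψ)  S ρ ρ′ ρσ≗ρ′ =
  cong₂ _×_ (⟦liftQF⟧ σ φ S ρ ρ′ ρσ≗ρ′) (⟦liftQF⟧ σ ψ S ρ ρ′ ρσ≗ρ′)
⟦liftQF⟧ σ (or φ ψ)   S ρ ρ′ ρσ≗ρ′ =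
  cong₂ _⊎_ (⟦liftQF⟧ σ φ S ρ ρ′ ρσ≗ρ′) (⟦liftQF⟧ σ ψ S ρ ρ′ ρσ≗ρ′)

pair-∘ : ∀ {A B : Set} (g : A → B) (x y : A) (z : Fin 2) → g (pair x y z) ≡ pair (g x) (g y) z
pair-∘ g x y Fin.zero    = refl
pair-∘ g x y (Fin.suc _) = refl

φAdjacent : ∀ {k m} → QF k 2 → Fin m → Fin m → QF (suc k) m
φAdjacent φ x y = and (neg (eq x y)) (or (liftQF (pair x y) φ) (liftQF (pair y x) φ))

⟦φAdjacent⟧ : ∀ {k m} (φ : QF k 2) (S : Str (suc k)) (ρ : Fin m → V S) x y →
              ⟦ φAdjacent φ x y ⟧ S ρ ⇔ φEdge φ (reduct S) (ρ x) (ρ y)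
⟦φAdjacent⟧ φ S ρ x y = mk⇔ (subst id same) (subst id (sym same))
  where
  same : ⟦ φAdjacent φ x y ⟧ S ρ ≡ φEdge φ (reduct S) (ρ x) (ρ y)
  same = cong₂ (λ A B → ¬ (ρ x ≡ ρ y) × (A ⊎ B))
    (⟦liftQF⟧ (pair x y) φ S ρ _ (pair-∘ ρ x y))
    (⟦liftQF⟧ (pair y x) φ S ρ _ (pair-∘ ρ y x))

⋀ : ∀ {k m n} → (Fin n → QF k m) → QF k m
⋀ {n = zero}  F = tt
⋀ {n = suc n} F = and (F Fin.zero) (⋀ (F ∘ Fin.suc))

⋀-intro : ∀ {k m n} (F : Fin n → QF k m) S ρ → (∀ t → ⟦ F t ⟧ S ρ) → ⟦ ⋀ F ⟧ S ρ
⋀-intro {n = zero}  F S ρ all = tt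
⋀-intro {n = suc n} F S ρ all = all Fin.zero , ⋀-intro (F ∘ Fin.suc) S ρ (all ∘ Fin.suc)

⋀-elim : ∀ {k m n} (F : Fin n → QF k m) S ρ → ⟦ ⋀ F ⟧ S ρ → ∀ t → ⟦ F t ⟧ S ρ
⋀-elim {n = suc n} F S ρ (F₀ , _)  Fin.zero    = F₀
⋀-elim {n = suc n} F S ρ (_ , Fₛ) (Fin.suc t) = ⋀-elim (F ∘ Fin.suc) S ρ Fₛ t

record MarkedWalk {k} (φ : QF k 2) (S : Str k) (Q : V S → Bool) (r′ : ℕ) (u v : V S) : Set where
  field
    vertex : Fin (suc r′) → V S
    marked : ∀ t → Q (vertex t) ≡ true
    first  : φEdge φ S u (vertex Fin.zero)
    step   : ∀ t → φEdge φ S (vertex (inject₁ t)) (vertex (Fin.suc t))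
    last   : φEdge φ S (vertex (fromℕ r′)) v

module WalkFormula {k} (φ : QF k 2) (r′ : ℕ) where

  x y : Fin (2 + suc r′)
  x = Fin.zero
  y = Fin.suc Fin.zero

  z : Fin (suc r′) → Fin (2 + suc r′)
  z t = 2 ↑ʳ t

  zMarked : Fin (suc r′) → QF (suc k) (2 + suc r′)
  zMarked t = pr Fin.zero (z t)

  zStep : Fin r′ → QF (suc k) (2 + suc r′)
  zStep t = φAdjacent φ (z (inject₁ t)) (z (Fin.suc t))

  markedWalkFormula : Existential (suc k) 2
  markedWalkFormula = ∃∃ (suc r′)
    (and (⋀ zMarked) (and (φAdjacent φ x (z Fin.zero)) (and (⋀ zStep) (φAdjacent φ (z (fromℕ r′)) y))))

open WalkFormula using (markedWalkFormula)

⟦markedWalkFormula⟧ : ∀ {k} (φ : QF k 2) (r′ : ℕ) (S : Str k) (Q : V S → Bool) (u v : V S) →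
  ⟦ markedWalkFormula φ r′ ⟧∃ (expand S Q) (pair u v) ⇔ MarkedWalk φ S Q r′ u v
⟦markedWalkFormula⟧ {k} φ r′ S Q u v = mk⇔ toWalk fromWalk
  where
  open WalkFormula φ r′ using (zMarked; zStep)
  S⁺ : Str (suc k)
  S⁺ = expand S Q

  adjacent : ∀ ρ x y → ⟦ φAdjacent φ x y ⟧ S⁺ ρ ⇔ φEdge φ S (ρ x) (ρ y)
  adjacent = ⟦φAdjacent⟧ φ S⁺

  toWalk : ⟦ markedWalkFormula φ r′ ⟧∃ S⁺ (pair u v) → MarkedWalk φ S Q r′ u v
  toWalk (σ , marks , first , steps , last) = record
    { vertex = σ
    ; marked = ⋀-elim zMarked S⁺ ρ marks
    ; first  = Equivalence.to (adjacent ρ _ _) first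
    ; step   = λ t → Equivalence.to (adjacent ρ _ _) (⋀-elim zStep S⁺ ρ steps t)
    ; last   = Equivalence.to (adjacent ρ _ _) last
    }
    where
    ρ : Fin (2 + suc r′) → V S
    ρ = pair u v VF.++ σ

  fromWalk : MarkedWalk φ S Q r′ u v → ⟦ markedWalkFormula φ r′ ⟧∃ S⁺ (pair u v)
  fromWalk w = vertex
             , ⋀-intro zMarked S⁺ ρ marked
             , Equivalence.from (adjacent ρ _ _) first
             , ⋀-intro zStep S⁺ ρ (λ t → Equivalence.from (adjacent ρ _ _) (step t))
             , Equivalence.from (adjacent ρ _ _) last
    where
    open MarkedWalk w
    ρ : Fin (2 + suc r′) → V S
    ρ = pair u v VF.++ vertex

prin-adj-inner⇒endpoint : ∀ {n r} {x p q : Fin n} .{p<q} {s : Fin r} →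
                          SubAdj (prin x) (inner p q p<q s) → x ≡ p ⊎ x ≡ q
prin-adj-inner⇒endpoint (inj₁ (start _ _ _ _ _)) = inj₁ refl
prin-adj-inner⇒endpoint (inj₂ (end _ _ _ _ _))   = inj₂ refl

inner-adj-inner⇒same-source : ∀ {n r} {p q p′ q′ : Fin n} .{p<q p′<q′} {s s′ : Fin r} →
                              SubAdj (inner p q p<q s) (inner p′ q′ p′<q′ s′) → p ≡ p′
inner-adj-inner⇒same-source (inj₁ (mid _ _ _ _ _ _)) = refl
inner-adj-inner⇒same-source (inj₂ (mid _ _ _ _ _ _)) = refl

module Principal (n : ℕ) where

  element : Fin n → Fin (n + 2 ^ n)
  element i = i ↑ˡ 2 ^ n

  subset : Fin (2 ^ n) → Fin (n + 2 ^ n)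
  subset c = n ↑ʳ c

  element<subset : ∀ i c → element i <ᶠ subset c
  element<subset i c = begin-strict
    toℕ (element i) ≡⟨ toℕ-↑ˡ i (2 ^ n) ⟩
    toℕ i           <⟨ toℕ<n i ⟩
    n               ≤⟨ m≤m+n n (toℕ c) ⟩
    n + toℕ c       ≡⟨ toℕ-↑ʳ n c ⟨
    toℕ (subset c)  ∎
    where open ≤-Reasoning

  element≢subset : ∀ i c → element i ≢ subset c
  element≢subset i c = <⇒≢ (element<subset i c)

module Marking {k} (φ : QF k 2) (S : Str k) (n r′ : ℕ)
               (f : SubV (n + 2 ^ n) (suc r′) → V S)
               (f-induced : ∀ a b → SubAdj a b ⇔ φEdge φ S (f a) (f b)) where

  open Principal n

  pathVertex : Fin n → Fin (2 ^ n) → Fin (suc r′) → SubV (n + 2 ^ n) (suc r′)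
  pathVertex i c = inner (element i) (subset c) (element<subset i c)

  record OnMarkedPath (x : V S) : Set where
    constructor onPath
    field
      elementOf  : Fin n
      subsetOf   : Fin (2 ^ n)
      positionOf : Fin (suc r′)
      isMember   : elementOf ∈ᶜ subsetOf ≡ true
      image      : f (pathVertex elementOf subsetOf positionOf) ≡ x

  onMarkedPath? : ∀ x → Dec (OnMarkedPath x)
  onMarkedPath? x =
    map′ (λ (i , c , t , i∈c , fx) → onPath i c t i∈c fx)
         (λ (onPath i c t i∈c fx) → i , c , t , i∈c , fx)
         (any? λ i → any? λ c → any? λ t →
            (i ∈ᶜ c ≟ᵇ true) ×-dec (f (pathVertex i c t) ≟ᶠ x))

  mark : V S → Bool
  mark x = isYes (onMarkedPath? x)

  mark-sound : ∀ {x} → mark x ≡ true → OnMarkedPath x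
  mark-sound = toWitness ∘ Equivalence.from T-≡

  mark-complete : ∀ {x} → OnMarkedPath x → mark x ≡ true
  mark-complete = Equivalence.to T-≡ ∘ fromWitness

  elementImage : Fin n → V S
  elementImage i = f (prin (element i))

  subsetImage : Fin (2 ^ n) → V S
  subsetImage c = f (prin (subset c))

  markedPath-walk : ∀ {i c} → i ∈ᶜ c ≡ true →
                    MarkedWalk φ S mark r′ (elementImage i) (subsetImage c)
  markedPath-walk {i} {c} i∈c = record
    { vertex = f ∘ pathVertex i c
    ; marked = λ t → mark-complete (onPath i c t i∈c refl)
    ; first  = push (inj₁ (start _ _ _ Fin.zero refl))
    ; step   = λ t → push (inj₁ (mid _ _ _ (inject₁ t) (Fin.suc t) (cong suc (sym (toℕ-inject₁ t)))))
    ; last   = push (inj₁ (end _ _ _ (fromℕ r′) (cong suc (toℕ-fromℕ r′))))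
    }
    where
    push : ∀ {a b} → SubAdj a b → φEdge φ S (f a) (f b)
    push = Equivalence.to (f-induced _ _)

  pull : ∀ {a b x y} → f a ≡ x → f b ≡ y → φEdge φ S x y → SubAdj a b
  pull refl refl = Equivalence.from (f-induced _ _)

  walk⇒∈ᶜ : ∀ {i c} → MarkedWalk φ S mark r′ (elementImage i) (subsetImage c) → i ∈ᶜ c ≡ true
  walk⇒∈ᶜ {i} {c} w = subst₂ (λ i′ c′ → i′ ∈ᶜ c′ ≡ true) sourceLast targetLast (isMember (on (fromℕ r′)))
    where
    open MarkedWalk w
    open OnMarkedPath

    on : ∀ t → OnMarkedPath (vertex t)
    on t = mark-sound (marked t)

    sourceFirst : elementOf (on Fin.zero) ≡ i
    sourceFirst with prin-adj-inner⇒endpoint (pull refl (image (on Fin.zero)) first)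
    ... | inj₁ e = sym (↑ˡ-injective (2 ^ n) _ _ e)
    ... | inj₂ e = ⊥-elim (element≢subset _ _ e)

    sourceStep : ∀ t → elementOf (on (inject₁ t)) ≡ i → elementOf (on (Fin.suc t)) ≡ i
    sourceStep t hyp = trans (sym (↑ˡ-injective (2 ^ n) _ _ same)) hyp
      where
      same : element (elementOf (on (inject₁ t))) ≡ element (elementOf (on (Fin.suc t)))
      same = inner-adj-inner⇒same-source (pull (image (on _)) (image (on _)) (step t))

    sourceLast : elementOf (on (fromℕ r′)) ≡ i
    sourceLast = <-weakInduction (λ t → elementOf (on t) ≡ i) sourceFirst sourceStep (fromℕ r′)

    targetLast : subsetOf (on (fromℕ r′)) ≡ c
    targetLast with prin-adj-inner⇒endpoint (swap (pull (image (on _)) refl last))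
    ... | inj₁ e = ⊥-elim (element≢subset _ _ (sym e))
    ... | inj₂ e = sym (↑ʳ-injective n _ _ e)

  markedWalk-shatters : ∀ i J →
    ⟦ markedWalkFormula φ r′ ⟧∃ (expand S mark) (pair (elementImage i) (subsetImage (subsetCode J)))
      ⇔ (J i ≡ true)
  markedWalk-shatters i J =
    mk⇔ (member⇒ ∘ walk⇒∈ᶜ ∘ Equivalence.to formula)
        (Equivalence.from formula ∘ markedPath-walk ∘ ⇒member)
    where
    formula : ⟦ markedWalkFormula φ r′ ⟧∃ (expand S mark)
                (pair (elementImage i) (subsetImage (subsetCode J)))
              ⇔ MarkedWalk φ S mark r′ (elementImage i) (subsetImage (subsetCode J))
    formula = ⟦markedWalkFormula⟧ φ r′ S mark _ _
    member⇒ : i ∈ᶜ subsetCode J ≡ true → J i ≡ true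
    member⇒ = trans (sym (∈ᶜ-subsetCode i J))
    ⇒member : J i ≡ true → i ∈ᶜ subsetCode J ≡ true
    ⇒member = trans (∈ᶜ-subsetCode i J)

mainTheorem8 : (C : GraphClass) →
    SimplyExistentiallyMonadicallyDependent C → PatternFree C
mainTheorem8 C dependent zero ()
mainTheorem8 C dependent (suc r′) _ k Ĉ Ĉ⊆C φ
  with n , notShattered ← dependent (suc k) (Ĉ ∘ reduct) (Ĉ⊆C ∘ reduct) (markedWalkFormula φ r′)
  = n + 2 ^ n , λ (S , S∈Ĉ , f , _ , f-induced) →
      let open Marking φ S n r′ f f-induced in
      notShattered ( expand S mark , S∈Ĉ , elementImage , subsetImage ∘ subsetCode
                   , markedWalk-shatters )
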